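{- (1) Let $(X,R,S,E)$ be a relational interchange monoid. Then for all $u,v,w,x\in X$: $R^x_{uv}\Rightarrow S^x_{uv}$; $R^x_{uv}\Rightarrow S^x_{vu}$; $(\exists y.\ R^x_{uy}\wedge S^y_{vw})\Rightarrow(\exists y.\ R^y_{uv}\wedge S^x_{yw})$; $(\exists y.\ S^y_{uv}\wedge R^x_{yw})\Rightarrow(\exists y.\ S^x_{uy}\wedge R^y_{vw})$; $(\exists y.\ R^x_{uy}\wedge S^y_{vw})\Rightarrow(\exists y.\ S^x_{vy}\wedge R^y_{uw})$; $(\exists y.\ S^y_{uv}\wedge R^x_{yw})\Rightarrow(\exists y.\ R^y_{uw}\wedge S^x_{yv})$. (2) Let $(Q,\le,\bullet,\diamond,1)$ be a unital interchange quantale. Then for all $a,b,c\in Q$: $a\bullet b\le a\diamond b$; $a\bullet b\le b\diamond a$; $a\bullet(b\diamond c)\le(a\bullet b)\diamond c$; $(a\diamond b)\bullet c\le a\diamond(b\bullet c)$; $a\bullet(b\diamond c)\le b\diamond(a\bullet c)$; $(a\diamond b)\bullet c\le(a\bullet c)\diamond b$.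
   Context: $R^x_{yz}$ means $R$ holds at $(x,y,z)$. A relational interchange monoid $(X,R,S,E)$: $R,S$ are ternary relations on $X$, each relationally associative (for all $x,u,v,w$: $(\exists y.\ R^y_{uv}\wedge R^x_{yw})\Leftrightarrow(\exists y.\ R^x_{uy}\wedge R^y_{vw})$, likewise for $S$), $E\subseteq X$ is a set of relational units for both (for all $x,y$: $\exists e\in E.\ R^x_{ex}$; $R^x_{ey}\wedge e\in E\Rightarrow x=y$; $\exists e\in E.\ R^x_{xe}$; $R^x_{ye}\wedge e\in E\Rightarrow x=y$; likewise for $S$), and for all $t,u,v,w,x$: $(\exists y,z.\ S^y_{tu}\wedge R^x_{yz}\wedge S^z_{vw})\Rightarrow(\exists y,z.\ R^y_{tv}\wedge S^x_{yz}\wedge R^z_{uw})$. A unital interchange quantale $(Q,\le,\bullet,\diamond,1)$: a complete lattice with two associative binary operations each preserving arbitrary sups in both arguments, with common two-sided unit $1$, satisfying $(a\diamond b)\bullet(c\diamond d)\le(a\bullet c)\diamond(b\bullet d)$ for all $a,b,c,d$. -}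

module Defs where

open import Level using (Level; _⊔_; suc)
open import Data.Product using (Σ; ∃; _×_; _,_)
open import Relation.Binary.PropositionalEquality using (_≡_)
open import Relation.Binary.Structures using (IsPartialOrder)

-- Ternary relation: Rel3 X ℓ,  R x y z  stands for  R^x_{yz}.
Rel3 : ∀ {a} → Set a → (ℓ : Level) → Set (a ⊔ suc ℓ)
Rel3 X ℓ = X → X → X → Set ℓ

module _ {a ℓ : Level} {X : Set a} where

  RelAssoc : Rel3 X ℓ → Set (a ⊔ ℓ)
  RelAssoc R = ∀ x u v w →
      ((∃ λ y → R y u v × R x y w) → (∃ λ y → R x u y × R y v w))
    × ((∃ λ y → R x u y × R y v w) → (∃ λ y → R y u v × R x y w))

  RelUnits : Rel3 X ℓ → (X → Set ℓ) → Set (a ⊔ ℓ)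
  RelUnits R E =
      (∀ x → ∃ λ e → E e × R x e x)
    × (∀ x y e → E e → R x e y → x ≡ y)
    × (∀ x → ∃ λ e → E e × R x x e)
    × (∀ x y e → E e → R x y e → x ≡ y)

  RelInterchange : Rel3 X ℓ → Rel3 X ℓ → Set (a ⊔ ℓ)
  RelInterchange R S = ∀ t u v w x →
    (∃ λ y → ∃ λ z → S y t u × R x y z × S z v w) →
    (∃ λ y → ∃ λ z → R y t v × S x y z × R z u w)

record RelInterchangeMonoid (a ℓ : Level) : Set (suc (a ⊔ ℓ)) where
  field
    X : Set a
    R : Rel3 X ℓ
    S : Rel3 X ℓ
    E : X → Set ℓ
    R-assoc : RelAssoc R
    S-assoc : RelAssoc S
    R-units : RelUnits R E
    S-units : RelUnits S E
    interchange : RelInterchange R S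

record UnitalInterchangeQuantale (c ℓ ι : Level) : Set (suc (c ⊔ ℓ ⊔ ι)) where
  infix  4 _≤_
  infixl 7 _•_ _◇_
  field
    Q : Set c
    _≤_ : Q → Q → Set ℓ
    isPartialOrder : IsPartialOrder _≡_ _≤_
    ⋁ : {I : Set ι} → (I → Q) → Q
    ⋁-upper : ∀ {I : Set ι} (f : I → Q) (i : I) → f i ≤ ⋁ f
    ⋁-least : ∀ {I : Set ι} (f : I → Q) (b : Q) → (∀ i → f i ≤ b) → ⋁ f ≤ b
    _•_ : Q → Q → Q
    _◇_ : Q → Q → Q
    𝟙 : Q
    •-assoc : ∀ x y z → (x • y) • z ≡ x • (y • z)
    ◇-assoc : ∀ x y z → (x ◇ y) ◇ z ≡ x ◇ (y ◇ z)
    •-⋁ˡ : ∀ {I : Set ι} (f : I → Q) (b : Q) → ⋁ f • b ≡ ⋁ (λ i → f i • b)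
    •-⋁ʳ : ∀ {I : Set ι} (a : Q) (f : I → Q) → a • ⋁ f ≡ ⋁ (λ i → a • f i)
    ◇-⋁ˡ : ∀ {I : Set ι} (f : I → Q) (b : Q) → ⋁ f ◇ b ≡ ⋁ (λ i → f i ◇ b)
    ◇-⋁ʳ : ∀ {I : Set ι} (a : Q) (f : I → Q) → a ◇ ⋁ f ≡ ⋁ (λ i → a ◇ f i)
    •-identityˡ : ∀ x → 𝟙 • x ≡ x
    •-identityʳ : ∀ x → x • 𝟙 ≡ x
    ◇-identityˡ : ∀ x → 𝟙 ◇ x ≡ x
    ◇-identityʳ : ∀ x → x ◇ 𝟙 ≡ x
    interchange : ∀ a b c d → (a ◇ b) • (c ◇ d) ≤ (a • c) ◇ (b • d)

module Submission where

-- Every one of them is the interchange law with the unit put in one or two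
-- of its four argument positions.  On the relational side the inserted
-- unit is produced by the existence half of the unit axioms for S, and is
-- removed again by the uniqueness half of the unit axioms for R.  On the
-- quantale side the unit laws rewrite both sides of the interchange
-- inequality.

open import Defs
open import Level using (Level)
open import Data.Product using (∃; _×_; _,_; proj₁; proj₂)
open import Relation.Binary.PropositionalEquality using (_≡_; refl; cong₂; subst; subst₂)

module RelInterchangeMonoidProperties {a ℓ : Level} (M : RelInterchangeMonoid a ℓ) where

  open RelInterchangeMonoid M

  S-unitˡ : ∀ x → ∃ λ e → E e × S x e x
  S-unitˡ = proj₁ S-units

  S-unitʳ : ∀ x → ∃ λ e → E e × S x x e
  S-unitʳ = proj₁ (proj₂ (proj₂ S-units))

  R-unitˡ-unique : ∀ x y e → E e → R x e y → x ≡ y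
  R-unitˡ-unique = proj₁ (proj₂ R-units)

  R-unitʳ-unique : ∀ x y e → E e → R x y e → x ≡ y
  R-unitʳ-unique = proj₂ (proj₂ (proj₂ R-units))

  R⊆S : ∀ {u v x} → R x u v → S x u v
  R⊆S {u} {v} {x} r =
    let (e  , eE  , su) = S-unitʳ u
        (e' , e'E , sv) = S-unitˡ v
        (y , z , ry , sx , rz) = interchange u e e' v x (u , v , su , r , sv)
    in subst₂ (S x) (R-unitʳ-unique y u e' e'E ry) (R-unitˡ-unique z v e eE rz) sx

  R⊆Sᵒᵖ : ∀ {u v x} → R x u v → S x v u
  R⊆Sᵒᵖ {u} {v} {x} r =
    let (e  , eE  , su) = S-unitˡ u
        (e' , e'E , sv) = S-unitʳ v
        (y , z , ry , sx , rz) = interchange e u v e' x (u , v , su , r , sv)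
    in subst₂ (S x) (R-unitˡ-unique y v e eE ry) (R-unitʳ-unique z u e' e'E rz) sx

  R-S-weak-assoc : ∀ {u v w x} →
    (∃ λ y → R x u y × S y v w) → (∃ λ y → R y u v × S x y w)
  R-S-weak-assoc {u} {v} {w} {x} (y₀ , r , s) =
    let (e , eE , su) = S-unitʳ u
        (y , z , ry , sx , rz) = interchange u e v w x (u , y₀ , su , r , s)
    in y , ry , subst (S x y) (R-unitˡ-unique z w e eE rz) sx

  S-R-weak-assoc : ∀ {u v w x} →
    (∃ λ y → S y u v × R x y w) → (∃ λ y → S x u y × R y v w)
  S-R-weak-assoc {u} {v} {w} {x} (y₀ , s , r) =
    let (e , eE , sw) = S-unitˡ w
        (y , z , ry , sx , rz) = interchange u v e w x (y₀ , w , s , r , sw)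
    in z , subst (λ y′ → S x y′ z) (R-unitʳ-unique y u e eE ry) sx , rz

  R-S-weak-exchange : ∀ {u v w x} →
    (∃ λ y → R x u y × S y v w) → (∃ λ y → S x v y × R y u w)
  R-S-weak-exchange {u} {v} {w} {x} (y₀ , r , s) =
    let (e , eE , su) = S-unitˡ u
        (y , z , ry , sx , rz) = interchange e u v w x (u , y₀ , su , r , s)
    in z , subst (λ y′ → S x y′ z) (R-unitˡ-unique y v e eE ry) sx , rz

  S-R-weak-exchange : ∀ {u v w x} →
    (∃ λ y → S y u v × R x y w) → (∃ λ y → R y u w × S x y v)
  S-R-weak-exchange {u} {v} {w} {x} (y₀ , s , r) =
    let (e , eE , sw) = S-unitʳ w
        (y , z , ry , sx , rz) = interchange u v w e x (y₀ , w , s , r , sw)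
    in y , ry , subst (S x y) (R-unitʳ-unique z v e eE rz) sx

module UnitalInterchangeProperties
  {c ℓ : Level} {Q : Set c} (_≤_ : Q → Q → Set ℓ)
  (_•_ _◇_ : Q → Q → Q) (𝟙 : Q)
  (•-identityˡ : ∀ x → 𝟙 • x ≡ x) (•-identityʳ : ∀ x → x • 𝟙 ≡ x)
  (◇-identityˡ : ∀ x → 𝟙 ◇ x ≡ x) (◇-identityʳ : ∀ x → x ◇ 𝟙 ≡ x)
  (interchange : ∀ a b c d → ((a ◇ b) • (c ◇ d)) ≤ ((a • c) ◇ (b • d)))
  where

  -- The interchange law with both sides read up to given equations, so
  -- that each law below only has to say which unit equations simplify
  -- which of the four compound terms.
  interchange-up-to : ∀ {a b c d p q r s} →
    (a ◇ b) ≡ p → (c ◇ d) ≡ q → (a • c) ≡ r → (b • d) ≡ s → (p • q) ≤ (r ◇ s)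
  interchange-up-to {a} {b} {c} {d} ab≡p cd≡q ac≡r bd≡s =
    subst₂ _≤_ (cong₂ _•_ ab≡p cd≡q) (cong₂ _◇_ ac≡r bd≡s) (interchange a b c d)

  -- a • b ≤ a ◇ b :  interchange on (a ◇ 𝟙) • (𝟙 ◇ b).
  •≤◇ : ∀ a b → (a • b) ≤ (a ◇ b)
  •≤◇ a b = interchange-up-to (◇-identityʳ a) (◇-identityˡ b) (•-identityʳ a) (•-identityˡ b)

  -- a • b ≤ b ◇ a :  interchange on (𝟙 ◇ a) • (b ◇ 𝟙).
  •≤◇ᵒᵖ : ∀ a b → (a • b) ≤ (b ◇ a)
  •≤◇ᵒᵖ a b = interchange-up-to (◇-identityˡ a) (◇-identityʳ b) (•-identityˡ b) (•-identityʳ a)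

  -- a • (b ◇ c) ≤ (a • b) ◇ c :  interchange on (a ◇ 𝟙) • (b ◇ c).
  •-◇-weak-assoc : ∀ a b c → (a • (b ◇ c)) ≤ ((a • b) ◇ c)
  •-◇-weak-assoc a b c = interchange-up-to (◇-identityʳ a) refl refl (•-identityˡ c)

  -- (a ◇ b) • c ≤ a ◇ (b • c) :  interchange on (a ◇ b) • (𝟙 ◇ c).
  ◇-•-weak-assoc : ∀ a b c → ((a ◇ b) • c) ≤ (a ◇ (b • c))
  ◇-•-weak-assoc a b c = interchange-up-to refl (◇-identityˡ c) (•-identityʳ a) refl

  -- a • (b ◇ c) ≤ b ◇ (a • c) :  interchange on (𝟙 ◇ a) • (b ◇ c).
  •-◇-weak-exchange : ∀ a b c → (a • (b ◇ c)) ≤ (b ◇ (a • c))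
  •-◇-weak-exchange a b c = interchange-up-to (◇-identityˡ a) refl (•-identityˡ b) refl

  -- (a ◇ b) • c ≤ (a • c) ◇ b :  interchange on (a ◇ b) • (c ◇ 𝟙).
  ◇-•-weak-exchange : ∀ a b c → ((a ◇ b) • c) ≤ ((a • c) ◇ b)
  ◇-•-weak-exchange a b c = interchange-up-to refl (◇-identityʳ c) refl (•-identityʳ b)

corollary5p5 : ∀ {ℓx ℓr ℓq ℓo ℓi : Level} →
    ((M : RelInterchangeMonoid ℓx ℓr) →
      let open RelInterchangeMonoid M in
      ∀ u v w x →
          (R x u v → S x u v)
        × (R x u v → S x v u)
        × ((∃ λ y → R x u y × S y v w) → (∃ λ y → R y u v × S x y w))
        × ((∃ λ y → S y u v × R x y w) → (∃ λ y → S x u y × R y v w))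
        × ((∃ λ y → R x u y × S y v w) → (∃ λ y → S x v y × R y u w))
        × ((∃ λ y → S y u v × R x y w) → (∃ λ y → R y u w × S x y v)))
  × ((Qt : UnitalInterchangeQuantale ℓq ℓo ℓi) →
      let open UnitalInterchangeQuantale Qt in
      ∀ a b c →
          (a • b ≤ a ◇ b)
        × (a • b ≤ b ◇ a)
        × (a • (b ◇ c) ≤ (a • b) ◇ c)
        × ((a ◇ b) • c ≤ a ◇ (b • c))
        × (a • (b ◇ c) ≤ b ◇ (a • c))
        × ((a ◇ b) • c ≤ (a • c) ◇ b))
corollary5p5 =
    (λ M u v w x →
      let open RelInterchangeMonoidProperties M in
        R⊆S , R⊆Sᵒᵖ
      , R-S-weak-assoc , S-R-weak-assoc
      , R-S-weak-exchange , S-R-weak-exchange)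
  , (λ Qt a b c →
      let open UnitalInterchangeQuantale Qt
          open UnitalInterchangeProperties _≤_ _•_ _◇_ 𝟙
                 •-identityˡ •-identityʳ ◇-identityˡ ◇-identityʳ interchange
      in  •≤◇ a b , •≤◇ᵒᵖ a b
        , •-◇-weak-assoc a b c , ◇-•-weak-assoc a b c
        , •-◇-weak-exchange a b c , ◇-•-weak-exchange a b c)
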